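{- Let $m>0$ and let $(X,R)$ be a frame. A point $a\in X$ satisfies $aRa$ iff $aR^{[m]}a$.
   Context: For $m>0$ and a relation $R$ on $X$, define $R^{[m]}_0=R$, $R^{[m]}_{n+1}=\left(\bigcup_{i\le n}R^{[m]}_i\right)^{m+1}\setminus Id_X$, and $R^{[m]}=\bigcup_{n<\omega}R^{[m]}_n$, where $Id_X$ is the diagonal on $X$. -}

module Defs where

open import Level using (Level; _⊔_; Lift)
open import Data.Nat using (ℕ; zero; suc)
open import Data.Product using (∃; _×_)
open import Data.Sum using (_⊎_)
open import Relation.Binary.Core using (Rel)
open import Relation.Binary.PropositionalEquality using (_≡_)
open import Relation.Nullary using (¬_)

record Frame (a ℓ : Level) : Set (Level.suc (a ⊔ ℓ)) where
  field
    Carrier : Set a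
    R       : Rel Carrier ℓ

private
  variable
    a ℓ : Level

-- Relational composition power:  (S ^ k) = S^k,  for k ≥ 1;  S ^ 1 = S,
-- S ^ (k+1) x y  iff  ∃ z. S x z and S^k z y.
-- We index by k' with  pow S k' = S^(k'+1).
pow : {X : Set a} → Rel X ℓ → ℕ → Rel X (a ⊔ ℓ)
pow {a = a} S zero    x y = Lift a (S x y)
pow S (suc k) x y = ∃ λ z → S x z × pow S k z y

mutual
  -- Rm R m n  =  R^{[m]}_n
  --   R^{[m]}_0     = R
  --   R^{[m]}_{n+1} = (⋃_{i ≤ n} R^{[m]}_i)^{m+1} \ Id_X
  Rm : {X : Set a} → Rel X ℓ → ℕ → ℕ → Rel X (a ⊔ ℓ)
  Rm {a = a} R m zero    x y = Lift a (R x y)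
  Rm R m (suc n) x y = pow (Below R m n) m x y × ¬ (x ≡ y)

  Below : {X : Set a} → Rel X ℓ → ℕ → ℕ → Rel X (a ⊔ ℓ)
  Below R m zero    x y = Rm R m zero x y
  Below R m (suc n) x y = Below R m n x y ⊎ Rm R m (suc n) x y

Rbrack : {X : Set a} → Rel X ℓ → ℕ → Rel X (a ⊔ ℓ)
Rbrack R m x y = ∃ λ n → Rm R m n x y

{-# OPTIONS --safe #-}
module Submission where

open import Defs
open import Level using (Level; lift)
open import Data.Nat using (ℕ; _>_; zero; suc)
open import Data.Product using (_,_)
open import Data.Empty using (⊥-elim)
open import Relation.Binary.Core using (Rel; _⇒_)
open import Relation.Binary.Definitions using (Irreflexive)
open import Relation.Binary.PropositionalEquality using (_≡_; refl)
open import Function.Bundles using (_⇔_; mk⇔)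

private
  variable
    a ℓ : Level
    X : Set a

R⊆Rbrack : (R : Rel X ℓ) (m : ℕ) → R ⇒ Rbrack R m
R⊆Rbrack R m r = zero , lift r

Rm-suc-irreflexive : (R : Rel X ℓ) (m n : ℕ) → Irreflexive _≡_ (Rm R m (suc n))
Rm-suc-irreflexive R m n refl (_ , x≢x) = x≢x refl

-- Every stage after the first removes the diagonal, so a loop of R^{[m]} can
-- only come from R itself; this holds for every m, including m = 0.
Rbrack-loop⇒R-loop : (R : Rel X ℓ) (m : ℕ) {x : X} → Rbrack R m x x → R x x
Rbrack-loop⇒R-loop R m (zero , lift r) = r
Rbrack-loop⇒R-loop R m (suc n , loop) = ⊥-elim (Rm-suc-irreflexive R m n refl loop)

proposition13 : {a ℓ : Level} (m : ℕ) → m > 0 → (F : Frame a ℓ) → (x : Frame.Carrier F) →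
    Frame.R F x x ⇔ Rbrack (Frame.R F) m x x
proposition13 m _ F x = mk⇔ (R⊆Rbrack R m) (Rbrack-loop⇒R-loop R m)
  where open Frame F
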